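{- A finite loopless multigraph $G$ is FO2-colorable if and only if it has a 2-coloring in which every induced monochromatic component is acyclic or unicyclic (contains at most one cycle).
   Context: Multigraphs may have parallel edges (two parallel edges form a cycle of length 2) but no loops. A functional orientation of $G$ is an assignment of directions to a set of edges such that every non-isolated (positive-degree) vertex has exactly one edge directed away from it; an edge may be assigned both directions or remain undirected. A 2-coloring is a partition of $V(G)$ into two sets $V_1,V_2$ (not necessarily independent). An induced monochromatic component is a connected component of the subgraph induced by $V_1$ or by $V_2$. $G$ is FO2-colorable if there are a 2-coloring and a functional orientation such that every edge whose endpoints have the same color is directed in at least one direction. -}

module Defs where

open import Data.Nat using (ℕ; zero; suc)
open import Data.Fin using (Fin; zero; suc; inject₁; fromℕ)
open import Data.Bool using (Bool)
open import Data.Product using (Σ; ∃; _×_; _,_; proj₁; proj₂)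
open import Data.Sum using (_⊎_)
open import Relation.Binary.PropositionalEquality using (_≡_; _≢_)
open import Relation.Nullary using (¬_)
open import Function using (_⇔_)
open import Function.Definitions using (Injective)

record Multigraph : Set where
  field
    n        : ℕ
    m        : ℕ
    ends     : Fin m → Fin n × Fin n
    loopless : ∀ e → proj₁ (ends e) ≢ proj₂ (ends e)

module _ (G : Multigraph) where
  open Multigraph G

  Vertex : Set
  Vertex = Fin n

  Edge : Set
  Edge = Fin m

  Joins : Edge → Vertex → Vertex → Set
  Joins e a b = ends e ≡ (a , b) ⊎ ends e ≡ (b , a)

  Incident : Edge → Vertex → Set
  Incident e v = proj₁ (ends e) ≡ v ⊎ proj₂ (ends e) ≡ v

  NonIsolated : Vertex → Set
  NonIsolated v = ∃ λ e → Incident e v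

  -- 2-coloring: partition of V into V₁ (false) and V₂ (true)
  Coloring : Set
  Coloring = Vertex → Bool

-- direction status of an edge (x , y): undirected, x→y, y→x, or both directions
data Dir : Set where
  undirected : Dir
  forward    : Dir
  backward   : Dir
  bothways   : Dir

data HasForward : Dir → Set where
  f-fwd  : HasForward forward
  f-both : HasForward bothways

data HasBackward : Dir → Set where
  b-bwd  : HasBackward backward
  b-both : HasBackward bothways

module _ (G : Multigraph) where
  open Multigraph G

  Orientation : Set
  Orientation = Edge G → Dir

  DirectedAway : Orientation → Edge G → Vertex G → Set
  DirectedAway o e v =
    (proj₁ (ends e) ≡ v × HasForward (o e)) ⊎ (proj₂ (ends e) ≡ v × HasBackward (o e))

  IsFunctional : Orientation → Set
  IsFunctional o = ∀ v → NonIsolated G v →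
    ∃ λ e → DirectedAway o e v × (∀ e′ → DirectedAway o e′ v → e′ ≡ e)

  Directed : Orientation → Edge G → Set
  Directed o e = o e ≢ undirected

  FO2-colorable : Set
  FO2-colorable = Σ (Coloring G) λ c → Σ Orientation λ o →
    IsFunctional o × (∀ e → c (proj₁ (ends e)) ≡ c (proj₂ (ends e)) → Directed o e)

  data MonoWalk (c : Coloring G) (b : Bool) : Vertex G → Vertex G → Set where
    here : ∀ {v} → c v ≡ b → MonoWalk c b v v
    step : ∀ {u w v} (e : Edge G) → c u ≡ b → Joins G e u w → MonoWalk c b w v → MonoWalk c b u v

  -- a cycle of length suc k ≥ 2: distinct vertices vs 0 … vs k and distinct edges,
  -- edge i joins vs i and vs (i+1), and the last edge joins vs k and vs 0.
  -- (length 2 = two distinct parallel edges)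
  record Cycle : Set where
    field
      k      : ℕ
      vs     : Fin (suc (suc k)) → Vertex G
      es     : Fin (suc (suc k)) → Edge G
      vs-inj : Injective _≡_ _≡_ vs
      es-inj : Injective _≡_ _≡_ es
      step-joins : ∀ (i : Fin (suc k)) → Joins G (es (inject₁ i)) (vs (inject₁ i)) (vs (suc i))
      last-joins : Joins G (es (fromℕ (suc k))) (vs (fromℕ (suc k))) (vs zero)

  OnCycle : Cycle → Edge G → Set
  OnCycle C e = ∃ λ i → Cycle.es C i ≡ e

  CycleInClass : Coloring G → Bool → Cycle → Set
  CycleInClass c b C = ∀ i → c (Cycle.vs C i) ≡ b

  -- every induced monochromatic component contains at most one cycle
  -- (cycles identified with their edge sets): any two cycles lying in the same
  -- induced monochromatic component have the same edge set.
  ComponentsAtMostUnicyclic : Coloring G → Set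
  ComponentsAtMostUnicyclic c = ∀ (b : Bool) (C₁ C₂ : Cycle) →
    CycleInClass c b C₁ → CycleInClass c b C₂ →
    MonoWalk c b (Cycle.vs C₁ zero) (Cycle.vs C₂ zero) →
    ∀ e → OnCycle C₁ e ⇔ OnCycle C₂ e

module Submission where

-- (⇒) Under a functional orientation every vertex has one out-edge, and every
-- monochromatic edge is the out-edge of an endpoint.  Around a monochromatic
-- cycle the out-edges must all point the same way, so the cycle is closed under
-- following out-edges and any two of its vertices reach each other that way.
-- A vertex joined to a cycle C₂ inside its colour class reaches C₂ by
-- out-edges; hence a cycle C₁ in the same component has all its vertices on
-- C₂, and its edges, being out-edges of those vertices, are edges of C₂.
--
-- (⇐) We let vertices own edges: a valid assignment gives each vertex at most
-- one incident monochromatic edge, and each edge at most one owner.  Following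
-- owned edges defines an orbit for every vertex.  A new monochromatic edge uw
-- is added by an augmenting path along the orbit of u (or w) when that orbit
-- reaches a free vertex; if both orbits run into cycles, the two orbits and uw
-- yield two different cycles in one component, contradicting unicyclicity.
-- Owning every monochromatic edge, plus an arbitrary edge at the remaining
-- non-isolated vertices, gives the functional orientation.

open import Defs
open import Data.Nat using (ℕ; zero; suc; _+_; _∸_; _≤_; _<_; z≤n; s≤s; _≤?_; _<?_)
import Data.Nat.Properties as ℕP
open import Data.Fin using (Fin; zero; suc; inject₁; fromℕ; fromℕ<; toℕ; _≟_)
import Data.Fin.Properties as FinP
import Data.Fin.Induction as FinInd
open import Data.Fin.Relation.Unary.Top as Top using (‵fromℕ; ‵inject₁)
open import Data.Bool as Bool using (Bool)
open import Data.Maybe using (Maybe; just; nothing; fromMaybe)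
import Data.Maybe.Properties as MaybeP
open import Data.Product using (Σ; ∃; _×_; _,_; proj₁; proj₂)
open import Data.Product.Properties using (,-injectiveˡ; ,-injectiveʳ)
open import Data.Sum using (_⊎_; inj₁; inj₂)
open import Data.Empty using (⊥; ⊥-elim)
open import Function using (id; _⇔_; mk⇔; Equivalence)
open import Function.Definitions using (Injective)
open import Relation.Nullary using (¬_; Dec; yes; no)
open import Relation.Binary.PropositionalEquality

-- The cyclic successor on Fin (suc n): i ↦ i + 1, and the last index ↦ 0.
-- Consecutive vertices of a Cycle are exactly vs j and vs (next j).
next : ∀ {n} → Fin (suc n) → Fin (suc n)
next j with Top.view j
... | ‵fromℕ = zero
... | ‵inject₁ i = suc i

next-inject₁ : ∀ {n} (i : Fin n) → next (inject₁ i) ≡ suc i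
next-inject₁ i rewrite Top.view-inject₁ i = refl

next-fromℕ : ∀ n → next (fromℕ n) ≡ zero
next-fromℕ n rewrite Top.view-fromℕ n = refl

next-surjective : ∀ {n} (j : Fin (suc n)) → ∃ λ p → next p ≡ j
next-surjective {n} zero = fromℕ n , next-fromℕ n
next-surjective (suc i) = inject₁ i , next-inject₁ i

next-irreflexive : ∀ {k} (j : Fin (suc (suc k))) → next j ≢ j
next-irreflexive j with Top.view j
... | ‵fromℕ = λ ()
... | ‵inject₁ i =
  λ eq → ℕP.1+n≢n (trans (cong toℕ eq) (FinP.toℕ-inject₁ i))

cyclic-induction : ∀ {n} (P : Fin (suc n) → Set) →
  P zero → (∀ j → P j → P (next j)) → ∀ j → P j
cyclic-induction P P₀ advance =
  FinInd.<-weakInduction P P₀ (λ i Pi → subst P (next-inject₁ i) (advance (inject₁ i) Pi))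

cyclic-induction⁻ : ∀ {n} (P : Fin (suc n) → Set) →
  P zero → (∀ j → P (next j) → P j) → ∀ j → P j
cyclic-induction⁻ {n} P P₀ advance =
  FinInd.>-weakInduction P (advance (fromℕ n) (subst P (sym (next-fromℕ n)) P₀))
    (λ i Psuc → advance (inject₁ i) (subst P (sym (next-inject₁ i)) Psuc))

≤-+-split : ∀ m {n p} → p ≤ m + n → p ≤ m ⊎ ∃ λ r → r < n × p ≡ m + suc r
≤-+-split zero {p = zero} _ = inj₁ z≤n
≤-+-split zero {p = suc p} le = inj₂ (p , le , refl)
≤-+-split (suc m) {p = zero} _ = inj₁ z≤n
≤-+-split (suc m) {p = suc p} (s≤s le) with ≤-+-split m le
... | inj₁ l = inj₁ (s≤s l)
... | inj₂ (r , lt , refl) = inj₂ (r , lt , refl)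

<-+-split : ∀ m {n p} → p < m + n → p < m ⊎ ∃ λ r → r < n × p ≡ m + r
<-+-split m lt with ≤-+-split m lt
... | inj₁ l = inj₁ l
... | inj₂ (r , r<n , eq) = inj₂ (r , r<n , ℕP.suc-injective (trans eq (ℕP.+-suc m r)))

∸-pred : ∀ {n p} → p < n → n ∸ p ≡ suc (n ∸ suc p)
∸-pred lt = ℕP.+-∸-assoc 1 lt

<⇒+suc : ∀ {s t} → s < t → ∃ λ k → t ≡ s + suc k
<⇒+suc {s} s<t = _ , sym (trans (ℕP.+-suc s _) (ℕP.m+[n∸m]≡n s<t))

+-positive : ∀ m n → (m ≡ 0 → n ≡ 0 → ⊥) → ∃ λ K → m + n ≡ suc K
+-positive (suc m) n _ = m + n , refl
+-positive zero (suc n) _ = n , refl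
+-positive zero zero both-zero = ⊥-elim (both-zero refl refl)

<-extend : ∀ {P : ℕ → Set} {j} → (∀ a → a < j → P a) → P j → ∀ a → a ≤ j → P a
<-extend below at-j a a≤j with ℕP.m≤n⇒m<n∨m≡n a≤j
... | inj₁ a<j = below a a<j
... | inj₂ refl = at-j

least-witness : ∀ {P : ℕ → Set} → (∀ j → Dec (P j)) → ∀ n → (∃ λ j → j < n × P j) →
                ∃ λ j → j < n × P j × (∀ i → i < j → ¬ P i)
least-witness P? zero (_ , () , _)
least-witness P? (suc n) (j , j<1+n , Pj) with ℕP.anyUpTo? P? n
... | yes below with least-witness P? n below
...   | (i , i<n , Pi , least) = i , ℕP.m<n⇒m<1+n i<n , Pi , least
least-witness P? (suc n) (j , j<1+n , Pj) | no none =
  j , j<1+n , Pj , λ i i<j Pi → none (i , ℕP.<-≤-trans i<j (ℕP.≤-pred j<1+n) , Pi)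

module GraphBasics (G : Multigraph) where
  open Multigraph G

  joins-sym : ∀ {e a b} → Joins G e a b → Joins G e b a
  joins-sym (inj₁ eq) = inj₂ eq
  joins-sym (inj₂ eq) = inj₁ eq

  joins-other : ∀ {e a b b′} → Joins G e a b → Joins G e a b′ → b ≡ b′
  joins-other (inj₁ p) (inj₁ q) = ,-injectiveʳ (trans (sym p) q)
  joins-other (inj₁ p) (inj₂ q) = trans (,-injectiveʳ (trans (sym p) q)) (,-injectiveˡ (trans (sym p) q))
  joins-other (inj₂ p) (inj₁ q) = trans (,-injectiveˡ (trans (sym p) q)) (,-injectiveʳ (trans (sym p) q))
  joins-other (inj₂ p) (inj₂ q) = ,-injectiveˡ (trans (sym p) q)

  joins-endpoint : ∀ {e a b p q} → Joins G e a b → Joins G e p q → a ≡ p ⊎ a ≡ q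
  joins-endpoint (inj₁ x) (inj₁ y) = inj₁ (,-injectiveˡ (trans (sym x) y))
  joins-endpoint (inj₁ x) (inj₂ y) = inj₂ (,-injectiveˡ (trans (sym x) y))
  joins-endpoint (inj₂ x) (inj₁ y) = inj₂ (,-injectiveʳ (trans (sym x) y))
  joins-endpoint (inj₂ x) (inj₂ y) = inj₁ (,-injectiveʳ (trans (sym x) y))

  joins-cong : ∀ {e e′ a a′ b b′} → e ≡ e′ → a ≡ a′ → b ≡ b′ → Joins G e a b → Joins G e′ a′ b′
  joins-cong refl refl refl j = j

  Mono : Coloring G → Edge G → Set
  Mono c e = c (proj₁ (ends e)) ≡ c (proj₂ (ends e))

  joins-mono : ∀ c {e u w} → Joins G e u w → c u ≡ c w → Mono c e
  joins-mono c (inj₁ refl) same = same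
  joins-mono c (inj₂ refl) same = sym same

  mono-joins : ∀ c {e u w} → Joins G e u w → Mono c e → c u ≡ c w
  mono-joins c (inj₁ refl) mono = mono
  mono-joins c (inj₂ refl) mono = sym mono

  module Walks (c : Coloring G) (b : Bool) where
    walk-start : ∀ {u v} → MonoWalk G c b u v → c u ≡ b
    walk-start (here cu) = cu
    walk-start (step _ cu _ _) = cu

    _++ʷ_ : ∀ {u v w} → MonoWalk G c b u v → MonoWalk G c b v w → MonoWalk G c b u w
    here _ ++ʷ q = q
    step e cu j p ++ʷ q = step e cu j (p ++ʷ q)

    walk-reverse : ∀ {u v} → MonoWalk G c b u v → MonoWalk G c b v u
    walk-reverse (here cu) = here cu
    walk-reverse (step e cu j p) = walk-reverse p ++ʷ step e (walk-start p) (joins-sym j) (here cu)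

module FO2⇒Unicyclic (G : Multigraph) (c : Coloring G) (o : Orientation G)
  (functional : IsFunctional G o)
  (mono-directed : ∀ e → GraphBasics.Mono G c e → Directed G o e) where
  open Multigraph G
  open GraphBasics G

  Away : Edge G → Vertex G → Set
  Away = DirectedAway G o

  away-incident : ∀ {e v} → Away e v → Incident G e v
  away-incident (inj₁ (p , _)) = inj₁ p
  away-incident (inj₂ (p , _)) = inj₂ p

  away-unique : ∀ {e e′ v} → Away e v → Away e′ v → e ≡ e′
  away-unique {e} {e′} {v} d d′ with functional v (e , away-incident d)
  ... | (_ , _ , unique) = trans (unique e d) (sym (unique e′ d′))

  directed-away : ∀ e → Directed G o e → Away e (proj₁ (ends e)) ⊎ Away e (proj₂ (ends e))
  directed-away e directed with o e
  ... | undirected = ⊥-elim (directed refl)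
  ... | forward    = inj₁ (inj₁ (refl , f-fwd))
  ... | backward   = inj₂ (inj₂ (refl , b-bwd))
  ... | bothways   = inj₁ (inj₁ (refl , f-both))

  mono-away : ∀ {e a b} → Joins G e a b → c a ≡ c b → Away e a ⊎ Away e b
  mono-away {e} j same with directed-away e (mono-directed e (joins-mono c j same)) | j
  ... | inj₁ d | inj₁ eq = inj₁ (subst (Away e) (cong proj₁ eq) d)
  ... | inj₂ d | inj₁ eq = inj₂ (subst (Away e) (cong proj₂ eq) d)
  ... | inj₁ d | inj₂ eq = inj₂ (subst (Away e) (cong proj₁ eq) d)
  ... | inj₂ d | inj₂ eq = inj₁ (subst (Away e) (cong proj₂ eq) d)

  data OutPath : Vertex G → Vertex G → Set where
    stay : ∀ {v} → OutPath v v
    move : ∀ {e u w v} → Away e u → Joins G e u w → OutPath w v → OutPath u v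

  _++ᵒ_ : ∀ {u v w} → OutPath u v → OutPath v w → OutPath u w
  stay ++ᵒ q = q
  move d j p ++ᵒ q = move d j (p ++ᵒ q)

  -- A monochromatic cycle is a union of out-edges oriented consistently
  -- around it, so it is closed under following out-edges.
  module AroundCycle (b : Bool) (C : Cycle G) (in-class : CycleInClass G c b C) where
    open Cycle C

    joins-next : ∀ j → Joins G (es j) (vs j) (vs (next j))
    joins-next j with Top.view j
    ... | ‵fromℕ = last-joins
    ... | ‵inject₁ i = step-joins i

    Forward Backward : Fin (suc (suc k)) → Set
    Forward j = Away (es j) (vs j)
    Backward j = Away (es j) (vs (next j))

    forward-or-backward : ∀ j → Forward j ⊎ Backward j
    forward-or-backward j = mono-away (joins-next j) (trans (in-class j) (sym (in-class (next j))))

    -- Once es j is the out-edge of vs (next j), es (next j) cannot be.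
    backward-next : ∀ j → Backward j → Backward (next j)
    backward-next j bw with forward-or-backward (next j)
    ... | inj₂ bw′ = bw′
    ... | inj₁ fw′ = ⊥-elim (next-irreflexive j (es-inj (away-unique fw′ bw)))

    forward-prev : ∀ j → Forward (next j) → Forward j
    forward-prev j fw with forward-or-backward j
    ... | inj₁ fw′ = fw′
    ... | inj₂ bw′ = ⊥-elim (next-irreflexive j (sym (es-inj (away-unique bw′ fw))))

    coherent : (∀ j → Forward j) ⊎ (∀ j → Backward j)
    coherent with forward-or-backward zero
    ... | inj₁ fw₀ = inj₁ (cyclic-induction⁻ Forward fw₀ forward-prev)
    ... | inj₂ bw₀ = inj₂ (cyclic-induction Backward bw₀ backward-next)

    InCycle : Vertex G → Set
    InCycle u = ∃ λ j → vs j ≡ u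

    cycle-out-edge : ∀ j → ∃ λ i → Away (es i) (vs j)
    cycle-out-edge j with coherent
    ... | inj₁ fw = j , fw j
    ... | inj₂ bw with next-surjective j
    ... | (p , refl) = p , bw p

    out-step-on-cycle : ∀ {u e w} → InCycle u → Away e u → Joins G e u w → InCycle w × OnCycle G C e
    out-step-on-cycle (j , refl) d jn with cycle-out-edge j
    ... | (i , d′) with away-unique d′ d
    ... | refl with joins-endpoint (joins-sym jn) (joins-next i)
    ... | inj₁ eq = (i , sym eq) , (i , refl)
    ... | inj₂ eq = (next i , sym eq) , (i , refl)

    outpath-on-cycle : ∀ {u v} → OutPath u v → InCycle u → InCycle v
    outpath-on-cycle stay inC = inC
    outpath-on-cycle (move d j p) inC = outpath-on-cycle p (proj₁ (out-step-on-cycle inC d j))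

    to-and-from-start : (∀ j → OutPath (vs j) (vs zero)) × (∀ j → OutPath (vs zero) (vs j))
    to-and-from-start with coherent
    ... | inj₁ fw =
      cyclic-induction⁻ (λ j → OutPath (vs j) (vs zero)) stay
        (λ j p → move (fw j) (joins-next j) p) ,
      cyclic-induction (λ j → OutPath (vs zero) (vs j)) stay
        (λ j p → p ++ᵒ move (fw j) (joins-next j) stay)
    ... | inj₂ bw =
      cyclic-induction (λ j → OutPath (vs j) (vs zero)) stay
        (λ j p → move (bw j) (joins-sym (joins-next j)) p) ,
      cyclic-induction⁻ (λ j → OutPath (vs zero) (vs j)) stay
        (λ j p → p ++ᵒ move (bw j) (joins-sym (joins-next j)) stay)

    cycle-connected : ∀ i j → OutPath (vs i) (vs j)
    cycle-connected i j = proj₁ to-and-from-start i ++ᵒ proj₂ to-and-from-start j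

  module TwoCycles (b : Bool) (C₁ C₂ : Cycle G)
    (cl₁ : CycleInClass G c b C₁) (cl₂ : CycleInClass G c b C₂) where
    module C₁ = AroundCycle b C₁ cl₁
    module C₂ = AroundCycle b C₂ cl₂
    open Walks c b

    walk-reaches : ∀ {w y} → MonoWalk G c b w y → C₂.InCycle y → ∃ λ v → OutPath w v × C₂.InCycle v
    walk-reaches (here _) onC = _ , stay , onC
    walk-reaches (step {u} e cu jn rest) onC with walk-reaches rest onC
    ... | (v , p , onv) with mono-away jn (trans cu (sym (walk-start rest)))
    ... | inj₁ d = v , move d jn p , onv
    -- Otherwise e is the out-edge of the next vertex w′: either w′ is on C₂
    -- (and so is u), or the out-path from w′ begins by crossing e back to u.
    ... | inj₂ d with p
    ... | stay = u , stay , proj₁ (C₂.out-step-on-cycle onv d (joins-sym jn))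
    ... | move d′ j′ p′ with away-unique d d′
    ... | refl with joins-other j′ (joins-sym jn)
    ... | refl = v , p′ , onv

    edges-included : MonoWalk G c b (Cycle.vs C₁ zero) (Cycle.vs C₂ zero) →
                     ∀ e → OnCycle G C₁ e → OnCycle G C₂ e
    edges-included walk e (i , refl) with walk-reaches walk (zero , refl)
    ... | (v , p , v-on-C₂) with C₁.outpath-on-cycle p (zero , refl)
    ... | (a , refl) = edge-on-C₂ (C₁.forward-or-backward i)
      where
      -- C₁ is strongly connected by out-edges and one of its vertices is on C₂.
      on-C₂ : ∀ j → C₂.InCycle (Cycle.vs C₁ j)
      on-C₂ j = C₂.outpath-on-cycle (C₁.cycle-connected a j) v-on-C₂

      edge-on-C₂ : C₁.Forward i ⊎ C₁.Backward i → OnCycle G C₂ (Cycle.es C₁ i)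
      edge-on-C₂ (inj₁ fw) = proj₂ (C₂.out-step-on-cycle (on-C₂ i) fw (C₁.joins-next i))
      edge-on-C₂ (inj₂ bw) = proj₂ (C₂.out-step-on-cycle (on-C₂ (next i)) bw (joins-sym (C₁.joins-next i)))

fo2⇒unicyclic : (G : Multigraph) → FO2-colorable G → Σ (Coloring G) (ComponentsAtMostUnicyclic G)
fo2⇒unicyclic G (c , o , functional , mono-directed) = c , λ b C₁ C₂ cl₁ cl₂ walk e →
  mk⇔ (TwoCycles.edges-included b C₁ C₂ cl₁ cl₂ walk e)
      (TwoCycles.edges-included b C₂ C₁ cl₂ cl₁ (Walks.walk-reverse c b walk) e)
  where open FO2⇒Unicyclic G c o functional mono-directed
        open GraphBasics G

module Paths (G : Multigraph) where
  open GraphBasics G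

  record Path (V : Vertex G → Set) (E : Edge G → Set) (x y : Vertex G) : Set where
    field
      len      : ℕ
      vert     : ℕ → Vertex G
      edge     : ℕ → Edge G
      start    : vert 0 ≡ x
      end      : vert len ≡ y
      joins    : ∀ p → p < len → Joins G (edge p) (vert p) (vert (suc p))
      vert-inj : ∀ {p q} → p ≤ len → q ≤ len → vert p ≡ vert q → p ≡ q
      edge-inj : ∀ {p q} → p < len → q < len → edge p ≡ edge q → p ≡ q
      vert-in  : ∀ p → p ≤ len → V (vert p)
      edge-in  : ∀ p → p < len → E (edge p)

  path-walk : ∀ {c b E x y} → Path (λ v → c v ≡ b) E x y → MonoWalk G c b x y
  path-walk {c} {b} {E} {x} {y} P = subst (λ v → MonoWalk G c b v y) start (walk-from len 0 (ℕP.+-identityʳ len))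
    where
    open Path P
    walk-from : ∀ d p → d + p ≡ len → MonoWalk G c b (vert p) y
    walk-from zero p refl = subst (MonoWalk G c b (vert len)) end (here (vert-in len ℕP.≤-refl))
    walk-from (suc d) p eq =
      step (edge p) (vert-in p (subst (p ≤_) eq (ℕP.m≤n+m p (suc d)))) (joins p (subst (p <_) eq (ℕP.m<n+m p (s≤s z≤n))))
        (walk-from d (suc p) (trans (ℕP.+-suc d p) eq))

  path-weaken : ∀ {V V′ E E′ x y} → (∀ {v} → V v → V′ v) → (∀ {q} → E q → E′ q) →
                Path V E x y → Path V′ E′ x y
  path-weaken V⊆ E⊆ P = record
    { len = len ; vert = vert ; edge = edge ; start = start ; end = end ; joins = joins
    ; vert-inj = vert-inj ; edge-inj = edge-inj
    ; vert-in = λ p le → V⊆ (vert-in p le)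
    ; edge-in = λ p lt → E⊆ (edge-in p lt) }
    where open Path P

  path-cast : ∀ {V E x x′ y y′} → x ≡ x′ → y ≡ y′ → Path V E x y → Path V E x′ y′
  path-cast x≡ y≡ P = record
    { len = len ; vert = vert ; edge = edge ; start = trans start x≡ ; end = trans end y≡
    ; joins = joins ; vert-inj = vert-inj ; edge-inj = edge-inj ; vert-in = vert-in ; edge-in = edge-in }
    where open Path P

  path-reverse : ∀ {V E x y} → Path V E x y → Path V E y x
  path-reverse {V} {E} {x} {y} P = record
    { len = len
    ; vert = λ p → vert (len ∸ p)
    ; edge = λ p → edge (len ∸ suc p)
    ; start = end
    ; end = trans (cong vert (ℕP.n∸n≡0 len)) start
    ; joins = λ p lt → subst (λ v → Joins G (edge (len ∸ suc p)) v (vert (len ∸ suc p)))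
                         (cong vert (sym (∸-pred lt))) (joins-sym (joins (len ∸ suc p) (back< lt)))
    ; vert-inj = λ {p} {q} lp lq eq → ℕP.∸-cancelˡ-≡ lp lq (vert-inj (ℕP.m∸n≤m len p) (ℕP.m∸n≤m len q) eq)
    ; edge-inj = λ lp lq eq → ℕP.suc-injective (ℕP.∸-cancelˡ-≡ lp lq (edge-inj (back< lp) (back< lq) eq))
    ; vert-in = λ p _ → vert-in (len ∸ p) (ℕP.m∸n≤m len p)
    ; edge-in = λ p lt → edge-in (len ∸ suc p) (back< lt) }
    where
    open Path P
    back< : ∀ {p} → p < len → len ∸ suc p < len
    back< {p} lt = subst (_≤ len) (∸-pred lt) (ℕP.m∸n≤m len p)

  module Join {V E x z y} (P : Path V E x z) (Q : Path V E z y)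
    (vert-disjoint : ∀ {p q} → p ≤ Path.len P → 0 < q → q ≤ Path.len Q → Path.vert P p ≢ Path.vert Q q)
    (edge-disjoint : ∀ {p q} → p < Path.len P → q < Path.len Q → Path.edge P p ≢ Path.edge Q q) where
    module P = Path P
    module Q = Path Q
    m n : ℕ
    m = P.len
    n = Q.len

    vert : ℕ → Vertex G
    vert p with p ≤? m
    ... | yes _ = P.vert p
    ... | no _ = Q.vert (p ∸ m)

    edge : ℕ → Edge G
    edge p with p <? m
    ... | yes _ = P.edge p
    ... | no _ = Q.edge (p ∸ m)

    vert-first : ∀ {p} → p ≤ m → vert p ≡ P.vert p
    vert-first {p} le with p ≤? m
    ... | yes _ = refl
    ... | no gt = ⊥-elim (gt le)

    vert-second : ∀ r → vert (m + suc r) ≡ Q.vert (suc r)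
    vert-second r with (m + suc r) ≤? m
    ... | yes le = ⊥-elim (ℕP.<-irrefl refl (ℕP.≤-trans (ℕP.m≤m+n (suc m) r) (subst (_≤ m) (ℕP.+-suc m r) le)))
    ... | no _ = cong Q.vert (ℕP.m+n∸m≡n m (suc r))

    vert-junction : ∀ r → r ≤ n → vert (m + r) ≡ Q.vert r
    vert-junction zero _ = trans (vert-first (ℕP.≤-reflexive (ℕP.+-identityʳ m)))
                             (trans (cong P.vert (ℕP.+-identityʳ m)) (trans P.end (sym Q.start)))
    vert-junction (suc r) _ = vert-second r

    edge-first : ∀ {p} → p < m → edge p ≡ P.edge p
    edge-first {p} lt with p <? m
    ... | yes _ = refl
    ... | no ge = ⊥-elim (ge lt)

    edge-second : ∀ r → edge (m + r) ≡ Q.edge r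
    edge-second r with (m + r) <? m
    ... | yes lt = ⊥-elim (ℕP.<-irrefl refl (ℕP.≤-trans (ℕP.m≤m+n (suc m) r) lt))
    ... | no _ = cong Q.edge (ℕP.m+n∸m≡n m r)

    joins : ∀ p → p < m + n → Joins G (edge p) (vert p) (vert (suc p))
    joins p lt with <-+-split m lt
    ... | inj₁ l = joins-cong (sym (edge-first l)) (sym (vert-first (ℕP.<⇒≤ l))) (sym (vert-first l)) (P.joins p l)
    ... | inj₂ (r , r<n , refl) =
      joins-cong (sym (edge-second r)) (sym (vert-junction r (ℕP.<⇒≤ r<n)))
        (sym (trans (cong vert (sym (ℕP.+-suc m r))) (vert-second r))) (Q.joins r r<n)

    vert-inj : ∀ {p q} → p ≤ m + n → q ≤ m + n → vert p ≡ vert q → p ≡ q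
    vert-inj {p} {q} lp lq eq with ≤-+-split m lp | ≤-+-split m lq
    ... | inj₁ l | inj₁ l′ = P.vert-inj l l′ (trans (sym (vert-first l)) (trans eq (vert-first l′)))
    ... | inj₂ (r , lt , refl) | inj₂ (r′ , lt′ , refl) =
      cong (λ s → m + s) (Q.vert-inj lt lt′ (trans (sym (vert-second r)) (trans eq (vert-second r′))))
    ... | inj₁ l | inj₂ (r′ , lt′ , refl) =
      ⊥-elim (vert-disjoint l (s≤s z≤n) lt′ (trans (sym (vert-first l)) (trans eq (vert-second r′))))
    ... | inj₂ (r , lt , refl) | inj₁ l′ =
      ⊥-elim (vert-disjoint l′ (s≤s z≤n) lt (trans (sym (vert-first l′)) (trans (sym eq) (vert-second r))))

    edge-inj : ∀ {p q} → p < m + n → q < m + n → edge p ≡ edge q → p ≡ q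
    edge-inj {p} {q} lp lq eq with <-+-split m lp | <-+-split m lq
    ... | inj₁ l | inj₁ l′ = P.edge-inj l l′ (trans (sym (edge-first l)) (trans eq (edge-first l′)))
    ... | inj₂ (r , lt , refl) | inj₂ (r′ , lt′ , refl) =
      cong (λ s → m + s) (Q.edge-inj lt lt′ (trans (sym (edge-second r)) (trans eq (edge-second r′))))
    ... | inj₁ l | inj₂ (r′ , lt′ , refl) =
      ⊥-elim (edge-disjoint l lt′ (trans (sym (edge-first l)) (trans eq (edge-second r′))))
    ... | inj₂ (r , lt , refl) | inj₁ l′ =
      ⊥-elim (edge-disjoint l′ lt (trans (sym (edge-first l′)) (trans (sym eq) (edge-second r))))

    vert-in : ∀ p → p ≤ m + n → V (vert p)
    vert-in p le with ≤-+-split m le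
    ... | inj₁ l = subst V (sym (vert-first l)) (P.vert-in p l)
    ... | inj₂ (r , lt , refl) = subst V (sym (vert-second r)) (Q.vert-in (suc r) lt)

    edge-in : ∀ p → p < m + n → E (edge p)
    edge-in p lt with <-+-split m lt
    ... | inj₁ l = subst E (sym (edge-first l)) (P.edge-in p l)
    ... | inj₂ (r , r<n , refl) = subst E (sym (edge-second r)) (Q.edge-in r r<n)

    path : Path V E x y
    path = record
      { len = m + n ; vert = vert ; edge = edge
      ; start = trans (vert-first z≤n) P.start
      ; end = trans (vert-junction n ℕP.≤-refl) Q.end
      ; joins = joins ; vert-inj = vert-inj ; edge-inj = edge-inj
      ; vert-in = vert-in ; edge-in = edge-in }

  module Close {V E x y} (P : Path V E x y) {K : ℕ} (len≡ : Path.len P ≡ suc K)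
    (e : Edge G) (closes : Joins G e y x) (fresh : ∀ {p} → p < Path.len P → Path.edge P p ≢ e) where
    open Path P

    bound : (i : Fin (suc (suc K))) → toℕ i ≤ len
    bound i = subst (toℕ i ≤_) (sym len≡) (ℕP.≤-pred (FinP.toℕ<n i))

    bound< : (j : Fin (suc K)) → toℕ j < len
    bound< j = subst (toℕ j <_) (sym len≡) (FinP.toℕ<n j)

    cycle-edge : Fin (suc (suc K)) → Edge G
    cycle-edge i with Top.view i
    ... | ‵fromℕ = e
    ... | ‵inject₁ j = edge (toℕ j)

    cycle-edge-inj : Injective _≡_ _≡_ cycle-edge
    cycle-edge-inj {i} {j} eq with Top.view i | Top.view j
    ... | ‵fromℕ | ‵fromℕ = refl
    ... | ‵fromℕ | ‵inject₁ j′ = ⊥-elim (fresh (bound< j′) (sym eq))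
    ... | ‵inject₁ i′ | ‵fromℕ = ⊥-elim (fresh (bound< i′) eq)
    ... | ‵inject₁ i′ | ‵inject₁ j′ = cong inject₁ (FinP.toℕ-injective (edge-inj (bound< i′) (bound< j′) eq))

    cycle-step-joins : ∀ (i : Fin (suc K)) →
      Joins G (cycle-edge (inject₁ i)) (vert (toℕ (inject₁ i))) (vert (suc (toℕ i)))
    cycle-step-joins i rewrite Top.view-inject₁ i | FinP.toℕ-inject₁ i = joins (toℕ i) (bound< i)

    cycle-last-joins : Joins G (cycle-edge (fromℕ (suc K))) (vert (toℕ (fromℕ (suc K)))) (vert 0)
    cycle-last-joins rewrite Top.view-fromℕ (suc K) | FinP.toℕ-fromℕ (suc K) =
      joins-cong refl (trans (sym end) (cong vert len≡)) (sym start) closes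

    cycle : Cycle G
    cycle = record
      { k = K
      ; vs = λ i → vert (toℕ i)
      ; es = cycle-edge
      ; vs-inj = λ {i} {j} eq → FinP.toℕ-injective (vert-inj (bound i) (bound j) eq)
      ; es-inj = cycle-edge-inj
      ; step-joins = cycle-step-joins
      ; last-joins = cycle-last-joins }

    cycle-start : Cycle.vs cycle zero ≡ x
    cycle-start = start

    cycle-vertices : ∀ i → V (Cycle.vs cycle i)
    cycle-vertices i = vert-in (toℕ i) (bound i)

    cycle-edges : ∀ {q} → OnCycle G cycle q → q ≡ e ⊎ E q
    cycle-edges (i , refl) with Top.view i
    ... | ‵fromℕ = inj₁ refl
    ... | ‵inject₁ j = inj₂ (edge-in (toℕ j) (bound< j))

    closing-edge-on-cycle : OnCycle G cycle e
    closing-edge-on-cycle = fromℕ (suc K) , closing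
      where closing : cycle-edge (fromℕ (suc K)) ≡ e
            closing rewrite Top.view-fromℕ (suc K) = refl

module Assignments (G : Multigraph) (c : Coloring G) where
  open Multigraph G
  open GraphBasics G

  Assignment : Set
  Assignment = Vertex G → Maybe (Edge G)

  record Valid (A : Assignment) : Set where
    field
      owned-incident : ∀ {v q} → A v ≡ just q → Incident G q v
      owned-mono     : ∀ {v q} → A v ≡ just q → Mono c q
      owner-unique   : ∀ {v v′ q} → A v ≡ just q → A v′ ≡ just q → v ≡ v′
  open Valid

  Owned : Assignment → Edge G → Set
  Owned A q = ∃ λ v → A v ≡ just q

  Free : Assignment → Vertex G → Set
  Free A v = A v ≡ nothing

  free? : ∀ A v → Dec (Free A v)
  free? A v = MaybeP.≡-dec _≟_ (A v) nothing

  owned-or-free : (mq : Maybe (Edge G)) → mq ≡ nothing ⊎ ∃ λ q → mq ≡ just q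
  owned-or-free nothing = inj₁ refl
  owned-or-free (just q) = inj₂ (q , refl)

  just≢nothing : ∀ {q : Edge G} → just q ≢ nothing
  just≢nothing ()

  -- The endpoint of q other than v (meaningful when q is incident to v).
  other : Edge G → Vertex G → Vertex G
  other q v with proj₁ (ends q) ≟ v
  ... | yes _ = proj₂ (ends q)
  ... | no _ = proj₁ (ends q)

  other-joins : ∀ {q v} → Incident G q v → Joins G q v (other q v)
  other-joins {q} {v} inc with proj₁ (ends q) ≟ v
  ... | yes p = inj₁ (cong (λ a → a , proj₂ (ends q)) p)
  ... | no ¬p with inc
  ... | inj₁ p = ⊥-elim (¬p p)
  ... | inj₂ p = inj₂ (cong (λ b → proj₁ (ends q) , b) p)

  no-loop : ∀ {q v} → ¬ Joins G q v v
  no-loop {q} (inj₁ eq) = loopless q (trans (cong proj₁ eq) (sym (cong proj₂ eq)))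
  no-loop {q} (inj₂ eq) = loopless q (trans (cong proj₁ eq) (sym (cong proj₂ eq)))

  joins-incident₂ : ∀ {q a b} → Joins G q a b → Incident G q b
  joins-incident₂ (inj₁ eq) = inj₂ (cong proj₂ eq)
  joins-incident₂ (inj₂ eq) = inj₁ (cong proj₁ eq)

  across : Maybe (Edge G) → Vertex G → Vertex G
  across (just q) v = other q v
  across nothing v = v

  successor : Assignment → Vertex G → Vertex G
  successor A v = across (A v) v

  successor-owned : ∀ A {v q} → A v ≡ just q → successor A v ≡ other q v
  successor-owned A {v} eq = cong (λ mq → across mq v) eq

  successor-free : ∀ A {v} → Free A v → successor A v ≡ v
  successor-free A {v} eq = cong (λ mq → across mq v) eq

  successor-joins : ∀ {A v q} → Valid A → A v ≡ just q → Joins G q v (successor A v)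
  successor-joins {A} valid eq =
    subst (Joins G _ _) (sym (successor-owned A eq)) (other-joins (owned-incident valid eq))

  orbit : Assignment → Vertex G → ℕ → Vertex G
  orbit A y zero = y
  orbit A y (suc a) = orbit A (successor A y) a

  orbit-suc : ∀ A y a → orbit A y (suc a) ≡ successor A (orbit A y a)
  orbit-suc A y zero = refl
  orbit-suc A y (suc a) = orbit-suc A (successor A y) a

  orbit-+ : ∀ A y s p → orbit A y (s + p) ≡ orbit A (orbit A y s) p
  orbit-+ A y zero p = refl
  orbit-+ A y (suc s) p = orbit-+ A (successor A y) s p

  Distinct : Assignment → Vertex G → ℕ → Set
  Distinct A x t = ∀ {a b} → a ≤ t → b ≤ t → orbit A x a ≡ orbit A x b → a ≡ b

  assign : Assignment → Vertex G → Edge G → Assignment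
  assign A x p v with v ≟ x
  ... | yes _ = just p
  ... | no _ = A v

  assign-here : ∀ A x p → assign A x p x ≡ just p
  assign-here A x p with x ≟ x
  ... | yes _ = refl
  ... | no x≢x = ⊥-elim (x≢x refl)

  assign-elsewhere : ∀ A x p {v} → v ≢ x → assign A x p v ≡ A v
  assign-elsewhere A x p {v} v≢x with v ≟ x
  ... | yes v≡x = ⊥-elim (v≢x v≡x)
  ... | no _ = refl

  assign-cases : ∀ A x p v → (v ≡ x × assign A x p v ≡ just p) ⊎ (v ≢ x × assign A x p v ≡ A v)
  assign-cases A x p v with v ≟ x
  ... | yes refl = inj₁ (refl , refl)
  ... | no v≢x = inj₂ (v≢x , refl)

  assign-valid : ∀ {A x p} → Valid A → ¬ Owned A p → Incident G p x → Mono c p → Valid (assign A x p)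
  assign-valid {A} {x} {p} valid unowned inc mono = record
    { owned-incident = λ {v} eq → proj₁ (owned v eq)
    ; owned-mono = λ {v} eq → proj₂ (owned v eq)
    ; owner-unique = unique }
    where
    owned : ∀ v {q} → assign A x p v ≡ just q → Incident G q v × Mono c q
    owned v eq with assign-cases A x p v
    ... | inj₁ (refl , atx) with MaybeP.just-injective (trans (sym atx) eq)
    ... | refl = inc , mono
    owned v eq | inj₂ (_ , away) = owned-incident valid (trans (sym away) eq) , owned-mono valid (trans (sym away) eq)
    unique : ∀ {v v′ q} → assign A x p v ≡ just q → assign A x p v′ ≡ just q → v ≡ v′
    unique {v} {v′} eq eq′ with assign-cases A x p v | assign-cases A x p v′
    ... | inj₁ (refl , _) | inj₁ (refl , _) = refl
    ... | inj₁ (refl , atx) | inj₂ (_ , away′) =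
      ⊥-elim (unowned (v′ , trans (sym away′) (trans eq′ (sym (trans (sym atx) eq)))))
    ... | inj₂ (_ , away) | inj₁ (refl , atx′) =
      ⊥-elim (unowned (v , trans (sym away) (trans eq (sym (trans (sym atx′) eq′)))))
    ... | inj₂ (_ , away) | inj₂ (_ , away′) = owner-unique valid (trans (sym away) eq) (trans (sym away′) eq′)

  orbit-assign : ∀ A x p a y → (∀ b → b < a → orbit A y b ≢ x) → orbit (assign A x p) y a ≡ orbit A y a
  orbit-assign A x p zero y avoids = refl
  orbit-assign A x p (suc a) y avoids =
    trans (cong (λ z → orbit (assign A x p) z a) (cong (λ mq → across mq y) (assign-elsewhere A x p (avoids 0 (s≤s z≤n)))))
          (orbit-assign A x p a (successor A y) (λ b lt → avoids (suc b) (s≤s lt)))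

  Extension : Assignment → Edge G → Set
  Extension A p = Σ Assignment λ A′ → Valid A′ × (∀ {q} → Owned A q → Owned A′ q) × Owned A′ p

  -- Augmenting path: if the orbit x = x₀, x₁, …, x_L is simple and ends at a
  -- free vertex, let x own p and each xᵢ₊₁ own the edge previously owned by xᵢ.
  augment : ∀ L {A x p} → Valid A → ¬ Owned A p → Incident G p x → Mono c p →
            Distinct A x L → Free A (orbit A x L) → Extension A p
  augment zero {A} {x} {p} valid unowned inc mono _ x-free =
    assign A x p , assign-valid valid unowned inc mono , keeps , (x , assign-here A x p)
    where
    keeps : ∀ {q} → Owned A q → Owned (assign A x p) q
    keeps (v , eq) with assign-cases A x p v
    ... | inj₁ (refl , _) = ⊥-elim (just≢nothing (trans (sym eq) x-free))
    ... | inj₂ (_ , away) = v , trans away eq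
  augment (suc L) {A} {x} {p} valid unowned inc mono distinct free with owned-or-free (A x)
  ... | inj₁ x-free = ⊥-elim (ℕP.0≢1+n (distinct z≤n (s≤s z≤n) (sym (successor-free A x-free))))
  ... | inj₂ (q , x-owns) = A″ , valid″ , keeps , owns-p
    where
    A′ : Assignment
    A′ = assign A x p
    x′ : Vertex G
    x′ = successor A x
    -- x gives up q, which is then free to be taken by its successor x′.
    released : ¬ Owned A′ q
    released (v , eq) with assign-cases A x p v
    ... | inj₁ (refl , atx) = unowned (v , trans x-owns (cong just (MaybeP.just-injective (trans (sym eq) atx))))
    ... | inj₂ (v≢x , away) = v≢x (owner-unique valid (trans (sym away) eq) x-owns)
    -- The orbit of x′ avoids x, so it is unaffected by the reassignment.
    orbit-shift : ∀ a → a ≤ L → orbit A′ x′ a ≡ orbit A x′ a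
    orbit-shift a a≤L = orbit-assign A x p a x′
      (λ b b<a eq → ℕP.1+n≢0 (distinct (s≤s (ℕP.≤-trans (ℕP.<⇒≤ b<a) a≤L)) z≤n eq))
    distinct′ : Distinct A′ x′ L
    distinct′ la lb eq = ℕP.suc-injective
      (distinct (s≤s la) (s≤s lb) (trans (sym (orbit-shift _ la)) (trans eq (orbit-shift _ lb))))
    free′ : Free A′ (orbit A′ x′ L)
    free′ = trans (cong A′ (orbit-shift L ℕP.≤-refl))
              (trans (assign-elsewhere A x p (λ eq → ℕP.1+n≢0 (distinct ℕP.≤-refl z≤n eq))) free)
    rest : Extension A′ q
    rest = augment L (assign-valid valid unowned inc mono) released
             (joins-incident₂ (successor-joins valid x-owns)) (owned-mono valid x-owns) distinct′ free′
    A″ : Assignment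
    A″ = proj₁ rest
    valid″ : Valid A″
    valid″ = proj₁ (proj₂ rest)
    keeps′ : ∀ {r} → Owned A′ r → Owned A″ r
    keeps′ = proj₁ (proj₂ (proj₂ rest))
    owns-p : Owned A″ p
    owns-p = keeps′ (x , assign-here A x p)
    keeps : ∀ {r} → Owned A r → Owned A″ r
    keeps (v , eq) with assign-cases A x p v
    ... | inj₁ (refl , _) = subst (Owned A″) (MaybeP.just-injective (trans (sym x-owns) eq)) (proj₂ (proj₂ (proj₂ rest)))
    ... | inj₂ (_ , away) = keeps′ (v , trans away eq)

  ReachesFree : Assignment → Vertex G → Set
  ReachesFree A x = ∃ λ L → Distinct A x L × Free A (orbit A x L)

  record EntersCycle (A : Assignment) (x : Vertex G) : Set where
    field
      s k      : ℕ
      distinct : Distinct A x (s + suc k)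
      busy     : ∀ a → a ≤ s + suc k → ¬ Free A (orbit A x a)
      returns  : orbit A x (suc (s + suc k)) ≡ orbit A x s

  orbit-not-simple : ∀ A x → ¬ Distinct A x n
  orbit-not-simple A x distinct with FinP.pigeonhole (ℕP.n<1+n n) (λ i → orbit A x (toℕ i))
  ... | (i , j , i<j , eq) =
    ℕP.<-irrefl (distinct (ℕP.≤-pred (FinP.toℕ<n i)) (ℕP.≤-pred (FinP.toℕ<n j)) eq) i<j

  busy-owns : ∀ {A v} → ¬ Free A v → ∃ λ q → A v ≡ just q
  busy-owns {A} {v} busy with owned-or-free (A v)
  ... | inj₁ free = ⊥-elim (busy free)
  ... | inj₂ owns = owns

  enters-cycle : ∀ {A x} s t → s < t → Distinct A x t → (∀ a → a ≤ t → ¬ Free A (orbit A x a)) →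
                 orbit A x (suc t) ≡ orbit A x s → EntersCycle A x
  enters-cycle s t s<t distinct busy back with <⇒+suc s<t
  ... | (k , refl) = record { s = s ; k = k ; distinct = distinct ; busy = busy ; returns = back }

  orbit-shape : ∀ {A} → Valid A → ∀ x → ReachesFree A x ⊎ EntersCycle A x
  orbit-shape {A} valid x = search n 0 (ℕP.+-identityʳ n) (λ { z≤n z≤n _ → refl }) (λ _ ())
    where
    -- Invariant: orbit points 0 … j are distinct and 0 … j - 1 are not free.
    search : ∀ d j → d + j ≡ n → Distinct A x j → (∀ a → a < j → ¬ Free A (orbit A x a)) →
             ReachesFree A x ⊎ EntersCycle A x
    search zero j refl distinct _ = ⊥-elim (orbit-not-simple A x distinct)
    search (suc d) j eq distinct busy with free? A (orbit A x j)
    ... | yes j-free = inj₁ (j , distinct , j-free)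
    ... | no j-busy with ℕP.anyUpTo? (λ s → orbit A x (suc j) ≟ orbit A x s) (suc j)
    ... | no none = search d (suc j) (trans (ℕP.+-suc d j) eq) distinct′ busy′
      where
      busy′ : ∀ a → a < suc j → ¬ Free A (orbit A x a)
      busy′ a a<1+j = <-extend busy j-busy a (ℕP.≤-pred a<1+j)
      distinct′ : Distinct A x (suc j)
      distinct′ {a} {b} la lb eq with ℕP.m≤n⇒m<n∨m≡n la | ℕP.m≤n⇒m<n∨m≡n lb
      ... | inj₁ a<1+j | inj₁ b<1+j = distinct (ℕP.≤-pred a<1+j) (ℕP.≤-pred b<1+j) eq
      ... | inj₂ refl | inj₁ b<1+j = ⊥-elim (none (b , b<1+j , eq))
      ... | inj₁ a<1+j | inj₂ refl = ⊥-elim (none (a , a<1+j , sym eq))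
      ... | inj₂ refl | inj₂ refl = refl
    ... | yes (s , s<1+j , back) with ℕP.m≤n⇒m<n∨m≡n (ℕP.≤-pred s<1+j)
    ... | inj₁ s<j = inj₂ (enters-cycle s j s<j distinct (<-extend busy j-busy) back)
    ... | inj₂ refl = ⊥-elim (no-loop (subst (Joins G _ _) (trans (sym (orbit-suc A x j)) back)
                                         (successor-joins valid (proj₂ (busy-owns {A} j-busy)))))

module Obstructions (G : Multigraph) (c : Coloring G) where
  open Multigraph G
  open GraphBasics G
  open Paths G
  open Assignments G c

  module Obstruction (unicyclic : ComponentsAtMostUnicyclic G c) {A : Assignment} (valid : Valid A)
    (e : Edge G) (e-mono : Mono c e) (e-unowned : ¬ Owned A e) where
    open Valid valid

    u w : Vertex G
    u = proj₁ (ends e)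
    w = proj₂ (ends e)

    b : Bool
    b = c u

    open Walks c b

    -- The edge owned by v (e serves as a dummy value at free vertices).
    owned-edge : Vertex G → Edge G
    owned-edge v = fromMaybe e (A v)

    owns-owned-edge : ∀ {v} → ¬ Free A v → A v ≡ just (owned-edge v)
    owns-owned-edge {v} busy with A v
    ... | just q = refl
    ... | nothing = ⊥-elim (busy refl)

    orbit-joins : ∀ y p → ¬ Free A (orbit A y p) →
                  Joins G (owned-edge (orbit A y p)) (orbit A y p) (orbit A y (suc p))
    orbit-joins y p busy =
      subst (Joins G _ _) (sym (orbit-suc A y p)) (successor-joins valid (owns-owned-edge busy))

    -- Owned edges are monochromatic, so the colour is constant along busy orbit points.
    orbit-colour : ∀ y a → (∀ p → p < a → ¬ Free A (orbit A y p)) → c (orbit A y a) ≡ c y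
    orbit-colour y zero _ = refl
    orbit-colour y (suc a) busy =
      trans (orbit-colour (successor A y) a (λ p lt → busy (suc p) (s≤s lt)))
            (sym (mono-joins c (successor-joins valid owns) (owned-mono owns)))
      where owns = owns-owned-edge (busy 0 (s≤s z≤n))

    OrbitUpTo : Vertex G → ℕ → Vertex G → Set
    OrbitUpTo y t v = ∃ λ p → p ≤ t × orbit A y p ≡ v

    OwnedBy : (Vertex G → Set) → Edge G → Set
    OwnedBy R q = ∃ λ v → R v × A v ≡ just q

    owned-by⇒owned : ∀ {R q} → OwnedBy R q → Owned A q
    owned-by⇒owned (v , _ , owns) = v , owns

    orbit-path : ∀ y t → Distinct A y t → (∀ p → p < t → ¬ Free A (orbit A y p)) →
                 Path (λ v → c v ≡ c y) (OwnedBy (OrbitUpTo y t)) y (orbit A y t)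
    orbit-path y t distinct busy = record
      { len = t
      ; vert = orbit A y
      ; edge = λ p → owned-edge (orbit A y p)
      ; start = refl
      ; end = refl
      ; joins = λ p lt → orbit-joins y p (busy p lt)
      ; vert-inj = distinct
      ; edge-inj = λ lp lq eq → distinct (ℕP.<⇒≤ lp) (ℕP.<⇒≤ lq)
          (owner-unique (owns-owned-edge (busy _ lp)) (trans (owns-owned-edge (busy _ lq)) (cong just (sym eq))))
      ; vert-in = λ p le → orbit-colour y p (λ q q<p → busy q (ℕP.<-≤-trans q<p le))
      ; edge-in = λ p lt → orbit A y p , (p , ℕP.<⇒≤ lt , refl) , owns-owned-edge (busy p lt) }

    restrict : ∀ {y t t′} → t′ ≤ t → Distinct A y t → Distinct A y t′
    restrict t′≤t distinct la lb = distinct (ℕP.≤-trans la t′≤t) (ℕP.≤-trans lb t′≤t)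

    module OrbitCycle {y : Vertex G} (E : EntersCycle A y) where
      open EntersCycle E public

      T : ℕ
      T = s + suc k

      z : Vertex G
      z = orbit A y s

      shift : ∀ p → orbit A y (s + p) ≡ orbit A z p
      shift = orbit-+ A y s

      into-T : ∀ {p} → p ≤ suc k → s + p ≤ T
      into-T = ℕP.+-monoʳ-≤ s

      z-distinct : Distinct A z (suc k)
      z-distinct lp lq eq = ℕP.+-cancelˡ-≡ s _ _
        (distinct (into-T lp) (into-T lq) (trans (shift _) (trans eq (sym (shift _)))))

      z-busy : ∀ p → p ≤ suc k → ¬ Free A (orbit A z p)
      z-busy p le = subst (λ v → ¬ Free A v) (shift p) (busy (s + p) (into-T le))

      segment : Path (λ v → c v ≡ c z) (OwnedBy (OrbitUpTo z (suc k))) z (orbit A z (suc k))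
      segment = orbit-path z (suc k) z-distinct (λ p lt → z-busy p (ℕP.<⇒≤ lt))

      closing : Edge G
      closing = owned-edge (orbit A z (suc k))

      closing-owner : A (orbit A y T) ≡ just closing
      closing-owner = subst (λ v → A v ≡ just closing) (sym (shift (suc k)))
                        (owns-owned-edge (z-busy (suc k) ℕP.≤-refl))

      closes : Joins G closing (orbit A z (suc k)) z
      closes = subst (Joins G closing (orbit A z (suc k))) returns′ (orbit-joins z (suc k) (z-busy (suc k) ℕP.≤-refl))
        where returns′ : orbit A z (suc (suc k)) ≡ z
              returns′ = trans (sym (shift (suc (suc k)))) (trans (cong (orbit A y) (ℕP.+-suc s (suc k))) returns)

      fresh : ∀ {p} → p < suc k → owned-edge (orbit A z p) ≢ closing
      fresh {p} lt eq = ℕP.<-irrefl (z-distinct (ℕP.<⇒≤ lt) ℕP.≤-refl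
        (owner-unique (owns-owned-edge (z-busy p (ℕP.<⇒≤ lt)))
          (trans (owns-owned-edge (z-busy (suc k) ℕP.≤-refl)) (cong just (sym eq))))) lt

      module C = Close segment refl closing closes fresh

      cycle : Cycle G
      cycle = C.cycle

      approach : MonoWalk G c (c y) y (Cycle.vs cycle zero)
      approach = subst (MonoWalk G c (c y) y) (sym C.cycle-start)
        (path-walk (orbit-path y s (restrict (ℕP.m≤m+n s (suc k)) distinct)
                      (λ p lt → busy p (ℕP.≤-trans (ℕP.<⇒≤ lt) (ℕP.m≤m+n s (suc k))))))

      in-class : CycleInClass G c (c y) cycle
      in-class i = trans (C.cycle-vertices i)
        (orbit-colour y s (λ p lt → busy p (ℕP.≤-trans (ℕP.<⇒≤ lt) (ℕP.m≤m+n s (suc k)))))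

      edges-owned : ∀ {q} → OnCycle G cycle q → OwnedBy (OrbitUpTo y T) q
      edges-owned on with C.cycle-edges on
      ... | inj₁ refl = orbit A y T , (T , ℕP.≤-refl , refl) , closing-owner
      ... | inj₂ (v , (p , p≤ , refl) , owns) = v , (s + p , into-T p≤ , shift p) , owns

    module BothEnterCycles (Eu : EntersCycle A u) (Ew : EntersCycle A w) where
      module U = OrbitCycle Eu
      module W = OrbitCycle Ew

      w-colour : c w ≡ b
      w-colour = sym e-mono

      Meets : ℕ → Set
      Meets a′ = ∃ λ a → a < suc U.T × orbit A u a ≡ orbit A w a′

      meets? : ∀ a′ → Dec (Meets a′)
      meets? a′ = ℕP.anyUpTo? (λ a → orbit A u a ≟ orbit A w a′) (suc U.T)

      -- If the orbits never meet, the cycles of u and w are joined through e,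
      -- so they share their edges; but the edges of W.cycle are owned by w's orbit.
      separate : ¬ (∃ λ a′ → a′ < suc W.T × Meets a′) → ⊥
      separate none with U.edges-owned (Equivalence.from same-edges W.C.closing-edge-on-cycle)
        where
        walk : MonoWalk G c b (Cycle.vs U.cycle zero) (Cycle.vs W.cycle zero)
        walk = walk-reverse U.approach ++ʷ step e refl (inj₁ refl) (subst (λ b′ → MonoWalk G c b′ w (Cycle.vs W.cycle zero)) w-colour W.approach)
        same-edges : OnCycle G U.cycle W.closing ⇔ OnCycle G W.cycle W.closing
        same-edges = unicyclic b U.cycle W.cycle U.in-class (λ i → trans (W.in-class i) w-colour) walk W.closing
      ... | (v , (a , a≤ , refl) , owns) = none (W.T , ℕP.≤-refl , a , s≤s a≤ , owner-unique owns W.closing-owner)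

      -- If they first meet at step a′ of w's orbit (at step a of u's), the two
      -- orbit segments and e form a cycle through e, in the component of U.cycle.
      module Lasso (a′ : ℕ) (a′≤ : a′ ≤ W.T) (a : ℕ) (a≤ : a ≤ U.T)
                   (meet : orbit A u a ≡ orbit A w a′) (first : ∀ r → r < a′ → ¬ Meets r) where
        u-part : Path (λ v → c v ≡ b) (Owned A) u (orbit A u a)
        u-part = path-weaken id owned-by⇒owned
          (orbit-path u a (restrict a≤ U.distinct) (λ p lt → U.busy p (ℕP.≤-trans (ℕP.<⇒≤ lt) a≤)))

        w-part : Path (λ v → c v ≡ b) (Owned A) (orbit A u a) w
        w-part = path-cast (sym meet) refl (path-reverse (path-weaken (λ eq → trans eq w-colour) owned-by⇒owned
          (orbit-path w a′ (restrict a′≤ W.distinct) (λ p lt → W.busy p (ℕP.≤-trans (ℕP.<⇒≤ lt) a′≤)))))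

        vert-disjoint : ∀ {p q} → p ≤ a → 0 < q → q ≤ a′ → orbit A u p ≢ orbit A w (a′ ∸ q)
        vert-disjoint p≤ q>0 q≤ eq = first _ (ℕP.∸-monoʳ-< q>0 q≤) (_ , s≤s (ℕP.≤-trans p≤ a≤) , eq)

        edge-disjoint : ∀ {p q} → p < a → q < a′ → owned-edge (orbit A u p) ≢ owned-edge (orbit A w (a′ ∸ suc q))
        edge-disjoint {p} {q} p< q< eq = first _ (ℕP.∸-monoʳ-< (s≤s z≤n) q<)
          (p , s≤s (ℕP.≤-trans (ℕP.<⇒≤ p<) a≤) ,
           owner-unique (owns-owned-edge (U.busy p (ℕP.≤-trans (ℕP.<⇒≤ p<) a≤)))
             (trans (owns-owned-edge (W.busy _ (ℕP.≤-trans (ℕP.m∸n≤m a′ (suc q)) a′≤))) (cong just (sym eq))))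

        path : Path (λ v → c v ≡ b) (Owned A) u w
        path = Join.path u-part w-part vert-disjoint edge-disjoint

        positive : ∃ λ K → a + a′ ≡ suc K
        positive = +-positive a a′ λ a≡0 a′≡0 →
          loopless e (trans (cong (orbit A u) (sym a≡0)) (trans meet (cong (orbit A w) a′≡0)))

        module D = Close path (proj₂ positive) e (inj₂ refl)
          (λ {p} lt eq → e-unowned (subst (Owned A) eq (Path.edge-in path p lt)))

        contradiction : ⊥
        contradiction with U.edges-owned (Equivalence.to same-edges D.closing-edge-on-cycle)
          where
          walk : MonoWalk G c b (Cycle.vs D.cycle zero) (Cycle.vs U.cycle zero)
          walk = subst (λ v → MonoWalk G c b v (Cycle.vs U.cycle zero)) (sym D.cycle-start) U.approach
          same-edges : OnCycle G D.cycle e ⇔ OnCycle G U.cycle e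
          same-edges = unicyclic b D.cycle U.cycle D.cycle-vertices U.in-class walk e
        ... | owned = e-unowned (owned-by⇒owned owned)

      impossible : ⊥
      impossible with ℕP.anyUpTo? meets? (suc W.T)
      ... | no none = separate none
      ... | yes found with least-witness meets? (suc W.T) found
      ... | (a′ , a′< , (a , a< , meet) , first) =
        Lasso.contradiction a′ (ℕP.≤-pred a′<) a (ℕP.≤-pred a<) meet first

module ChoiceOrientation (G : Multigraph) (choice : Vertex G → Maybe (Edge G))
  (chosen-incident : ∀ {v q} → choice v ≡ just q → Incident G q v)
  (unchosen-isolated : ∀ {v} → choice v ≡ nothing → ¬ NonIsolated G v) where
  open Multigraph G

  direction : ∀ {P Q : Set} → Dec P → Dec Q → Dir
  direction (yes _) (yes _) = bothways
  direction (yes _) (no _) = forward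
  direction (no _) (yes _) = backward
  direction (no _) (no _) = undirected

  forward-of : ∀ {P Q : Set} (p? : Dec P) (q? : Dec Q) → HasForward (direction p? q?) → P
  forward-of (yes p) _ _ = p
  forward-of (no _) (yes _) ()
  forward-of (no _) (no _) ()

  backward-of : ∀ {P Q : Set} (p? : Dec P) (q? : Dec Q) → HasBackward (direction p? q?) → Q
  backward-of _ (yes q) _ = q
  backward-of (yes _) (no _) ()
  backward-of (no _) (no _) ()

  forward-to : ∀ {P Q : Set} (p? : Dec P) (q? : Dec Q) → P → HasForward (direction p? q?)
  forward-to (yes _) (yes _) _ = f-both
  forward-to (yes _) (no _) _ = f-fwd
  forward-to (no ¬p) _ p = ⊥-elim (¬p p)

  backward-to : ∀ {P Q : Set} (p? : Dec P) (q? : Dec Q) → Q → HasBackward (direction p? q?)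
  backward-to (yes _) (yes _) _ = b-both
  backward-to (no _) (yes _) _ = b-bwd
  backward-to _ (no ¬q) q = ⊥-elim (¬q q)

  chose? : ∀ v q → Dec (choice v ≡ just q)
  chose? v q = MaybeP.≡-dec _≟_ (choice v) (just q)

  orientation : Orientation G
  orientation q = direction (chose? (proj₁ (ends q)) q) (chose? (proj₂ (ends q)) q)

  away⇒chosen : ∀ {q v} → DirectedAway G orientation q v → choice v ≡ just q
  away⇒chosen {q} (inj₁ (refl , fwd)) = forward-of (chose? _ q) (chose? _ q) fwd
  away⇒chosen {q} (inj₂ (refl , bwd)) = backward-of (chose? _ q) (chose? _ q) bwd

  chosen⇒away : ∀ {q v} → choice v ≡ just q → DirectedAway G orientation q v
  chosen⇒away {q} {v} chosen with chosen-incident chosen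
  ... | inj₁ refl = inj₁ (refl , forward-to (chose? _ q) (chose? _ q) chosen)
  ... | inj₂ refl = inj₂ (refl , backward-to (chose? _ q) (chose? _ q) chosen)

  functional : IsFunctional G orientation
  functional v non-isolated with choice v in chosen
  ... | nothing = ⊥-elim (unchosen-isolated chosen non-isolated)
  ... | just q = q , chosen⇒away chosen ,
                 λ q′ away → MaybeP.just-injective (trans (sym (away⇒chosen away)) chosen)

  away⇒directed : ∀ {q v} → DirectedAway G orientation q v → Directed G orientation q
  away⇒directed (inj₁ (_ , fwd)) is-undirected = no-forward (subst HasForward is-undirected fwd)
    where no-forward : ¬ HasForward undirected
          no-forward ()
  away⇒directed (inj₂ (_ , bwd)) is-undirected = no-backward (subst HasBackward is-undirected bwd)
    where no-backward : ¬ HasBackward undirected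
          no-backward ()

module Unicyclic⇒FO2 (G : Multigraph) (c : Coloring G) (unicyclic : ComponentsAtMostUnicyclic G c) where
  open Multigraph G
  open GraphBasics G
  open Assignments G c
  open Obstructions G c

  -- Every unowned monochromatic edge can be added to a valid assignment:
  -- otherwise both its endpoints' orbits run into cycles.
  extend : ∀ {A} → Valid A → ∀ {e} → Mono c e → ¬ Owned A e → Extension A e
  extend valid {e} mono unowned with orbit-shape valid (proj₁ (ends e))
  ... | inj₁ (L , distinct , free) = augment L valid unowned (inj₁ refl) mono distinct free
  ... | inj₂ enters-u with orbit-shape valid (proj₂ (ends e))
  ... | inj₁ (L , distinct , free) = augment L valid unowned (inj₂ refl) mono distinct free
  ... | inj₂ enters-w =
    ⊥-elim (Obstruction.BothEnterCycles.impossible unicyclic valid e mono unowned enters-u enters-w)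

  mono? : ∀ q → Dec (Mono c q)
  mono? q = c (proj₁ (ends q)) Bool.≟ c (proj₂ (ends q))

  owned? : ∀ A q → Dec (Owned A q)
  owned? A q = FinP.any? (λ v → MaybeP.≡-dec _≟_ (A v) (just q))

  include : ∀ {A} → Valid A → ∀ q →
    Σ Assignment λ A′ → Valid A′ × (∀ {r} → Owned A r → Owned A′ r) × (Mono c q → Owned A′ q)
  include {A} valid q with mono? q | owned? A q
  ... | no ¬mono | _ = A , valid , id , λ mono → ⊥-elim (¬mono mono)
  ... | yes _ | yes owned = A , valid , id , λ _ → owned
  ... | yes mono | no unowned with extend valid mono unowned
  ...   | (A′ , valid′ , keeps , owns) = A′ , valid′ , keeps , λ _ → owns

  empty-valid : Valid (λ _ → nothing)
  empty-valid = record { owned-incident = λ () ; owned-mono = λ () ; owner-unique = λ () }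

  cover : ∀ j → j ≤ m → Σ Assignment λ A → Valid A × (∀ q → toℕ q < j → Mono c q → Owned A q)
  cover zero _ = (λ _ → nothing) , empty-valid , λ q ()
  cover (suc j) j<m with cover j (ℕP.<⇒≤ j<m)
  ... | (A , valid , covers) with include valid (fromℕ< j<m)
  ... | (A′ , valid′ , keeps , new) = A′ , valid′ , covers′
    where
    covers′ : ∀ q → toℕ q < suc j → Mono c q → Owned A′ q
    covers′ q lt mono with ℕP.m≤n⇒m<n∨m≡n (ℕP.≤-pred lt)
    ... | inj₁ q<j = keeps (covers q q<j mono)
    ... | inj₂ q≡j = subst (λ r → Mono c r → Owned A′ r) (sym q≡new) new mono
      where q≡new : q ≡ fromℕ< j<m
            q≡new = FinP.toℕ-injective (trans q≡j (sym (FinP.toℕ-fromℕ< j<m)))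

  incident? : ∀ q v → Dec (Incident G q v)
  incident? q v with proj₁ (ends q) ≟ v | proj₂ (ends q) ≟ v
  ... | yes p | _ = yes (inj₁ p)
  ... | no _ | yes p = yes (inj₂ p)
  ... | no ¬p₁ | no ¬p₂ = no λ { (inj₁ p) → ¬p₁ p ; (inj₂ p) → ¬p₂ p }

  complete : Maybe (Edge G) → Vertex G → Maybe (Edge G)
  complete (just q) _ = just q
  complete nothing v with FinP.any? (λ q → incident? q v)
  ... | yes (q , _) = just q
  ... | no _ = nothing

  complete-incident : ∀ {A} → Valid A → ∀ {v q} → complete (A v) v ≡ just q → Incident G q v
  complete-incident {A} valid {v} chosen with A v in owns
  ... | just q = subst (λ r → Incident G r v) (MaybeP.just-injective chosen) (Valid.owned-incident valid owns)
  ... | nothing with FinP.any? (λ q → incident? q v)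
  ...   | yes (q , inc) = subst (λ r → Incident G r v) (MaybeP.just-injective chosen) inc
  complete-incident valid {v} () | nothing | no _

  complete-isolated : ∀ (A : Assignment) {v} → complete (A v) v ≡ nothing → ¬ NonIsolated G v
  complete-isolated A {v} none with A v
  ... | just q = ⊥-elim (just≢nothing none)
  ... | nothing with FinP.any? (λ q → incident? q v)
  ...   | yes _ = ⊥-elim (just≢nothing none)
  ...   | no ¬inc = ¬inc

unicyclic⇒fo2 : (G : Multigraph) → Σ (Coloring G) (ComponentsAtMostUnicyclic G) → FO2-colorable G
unicyclic⇒fo2 G (c , unicyclic) = c , orientation , functional , mono-directed
  where
  open GraphBasics G
  open Assignments G c
  open Unicyclic⇒FO2 G c unicyclic
  covered : Σ Assignment λ A → Valid A × (∀ q → toℕ q < Multigraph.m G → Mono c q → Owned A q)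
  covered = cover (Multigraph.m G) ℕP.≤-refl
  A : Assignment
  A = proj₁ covered
  open ChoiceOrientation G (λ v → complete (A v) v) (complete-incident (proj₁ (proj₂ covered))) (complete-isolated A)
  mono-directed : ∀ q → Mono c q → Directed G orientation q
  mono-directed q mono with proj₂ (proj₂ covered) q (FinP.toℕ<n q) mono
  ... | (v , owns) = away⇒directed (chosen⇒away {v = v} (cong (λ mq → complete mq v) owns))

corollary3 : (G : Multigraph) →
    FO2-colorable G ⇔ Σ (Coloring G) (λ c → ComponentsAtMostUnicyclic G c)
corollary3 G = mk⇔ (fo2⇒unicyclic G) (unicyclic⇒fo2 G)
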